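{- For every integer $k\geq 1$, $|G_k|=k!$.
   Context: A peg permutation of length $n$ is a word $\pi_1^{\varepsilon_1}\cdots\pi_n^{\varepsilon_n}$ where $\pi_1\cdots\pi_n$ is a permutation of $\{1,\dots,n\}$ in one-line notation and each $\varepsilon_i\in\{+,-,\bullet\}$. The sets $G_k$ (generating permutations of the prefix reversal model) are defined recursively: $G_1=\{1^-2^+\}$. Given $\pi^\varepsilon\in G_k$ and a position $i$ with $\varepsilon_i\in\{+,-\}$, write $\pi^\varepsilon=\alpha\,\pi_i^{\varepsilon_i}\,\beta$; let $\dot\alpha,\dot\beta$ be obtained from $\alpha,\beta$ by adding $1$ to every value greater than $\pi_i$ (decorations kept), and $\dot\alpha^R$ be $\dot\alpha$ written in reverse order with $+$ and $-$ swapped ($\bullet$ unchanged). If $\varepsilon_i=+$ produce $\pi_i^-\,\dot\alpha^R\,(\pi_i+1)^+\,\dot\beta$; if $\varepsilon_i=-$ produce $(\pi_i+1)^+\,\dot\alpha^R\,\pi_i^-\,\dot\beta$. $G_{k+1}$ is the set of all (distinct) peg permutations so produced from elements of $G_k$. -}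

module Defs where

open import Data.Nat using (ℕ; zero; suc; _+_; _<ᵇ_)
open import Data.Nat.Properties using () renaming (_≟_ to _≟ℕ_)
open import Data.Bool using (if_then_else_)
open import Data.List using (List; []; _∷_; _++_; map; reverse; concatMap; deduplicate)
open import Data.Product using (_×_; _,_)
open import Data.Product.Properties using (≡-dec)
open import Relation.Binary.PropositionalEquality using (_≡_; refl)
open import Relation.Nullary using (Dec; yes; no)
open import Data.List.Properties using () renaming (≡-dec to list-≡-dec)

data Decoration : Set where
  plus minus bullet : Decoration

_≟D_ : (a b : Decoration) → Dec (a ≡ b)
plus ≟D plus = yes refl
plus ≟D minus = no λ ()
plus ≟D bullet = no λ ()
minus ≟D plus = no λ ()
minus ≟D minus = yes refl
minus ≟D bullet = no λ ()
bullet ≟D plus = no λ ()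
bullet ≟D minus = no λ ()
bullet ≟D bullet = yes refl

PegPerm : Set
PegPerm = List (ℕ × Decoration)

_≟P_ : (p q : PegPerm) → Dec (p ≡ q)
_≟P_ = list-≡-dec (≡-dec _≟ℕ_ _≟D_)

flipD : Decoration → Decoration
flipD plus = minus
flipD minus = plus
flipD bullet = bullet

bump : ℕ → PegPerm → PegPerm
bump v = map λ { (x , e) → (if v <ᵇ x then suc x else x) , e }

revFlip : PegPerm → PegPerm
revFlip w = reverse (map (λ { (x , e) → x , flipD e }) w)

expandAt : PegPerm → ℕ → Decoration → PegPerm → List PegPerm
expandAt α v plus  β = ((v , minus) ∷ revFlip (bump v α) ++ (suc v , plus) ∷ bump v β) ∷ []
expandAt α v minus β = ((suc v , plus) ∷ revFlip (bump v α) ++ (v , minus) ∷ bump v β) ∷ []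
expandAt α v bullet β = []

childrenAux : PegPerm → PegPerm → List PegPerm
childrenAux α [] = []
childrenAux α ((v , e) ∷ β) = expandAt α v e β ++ childrenAux (α ++ (v , e) ∷ []) β

children : PegPerm → List PegPerm
children = childrenAux []

-- G k for k ≥ 1, as a duplicate-free list; G 0 is unused (set to empty)
G : ℕ → List PegPerm
G zero = []
G (suc zero) = ((1 , minus) ∷ (2 , plus) ∷ []) ∷ []
G (suc (suc k)) = deduplicate _≟P_ (concatMap children (G (suc k)))

-- Every element of G k is a word of length k + 1 with distinct values and no bullet, so it has
-- exactly k + 1 children, one per position, and its children are again of this kind. A child
-- determines both its parent and the position that produced it, so the children of distinct
-- elements (or positions) are distinct; deduplication therefore removes nothing and
-- |G (k + 1)| = (k + 1) · |G k|.

module Submission where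

open import Defs
open import Data.Bool using (true; false; if_then_else_)
open import Data.List
  using (List; []; _∷_; _++_; [_]; length; map; reverse; concatMap; deduplicate; downFrom; cartesianProduct)
open import Data.List.Properties
  using (map-++; map-∘; map-id; map-cong; length-++; length-map; length-reverse; reverse-map; reverse-involutive;
         ++-assoc; filter-all; length-downFrom)
open import Data.List.Relation.Unary.All using (All; []; _∷_)
import Data.List.Relation.Unary.All as All
import Data.List.Relation.Unary.All.Properties as All
open import Data.List.Relation.Unary.AllPairs using ([]; _∷_)
import Data.List.Relation.Unary.AllPairs as AllPairs
open import Data.List.Relation.Unary.Unique.Propositional using (Unique)
import Data.List.Relation.Unary.Unique.Propositional.Properties as Unique
open import Data.List.Relation.Binary.Permutation.Propositional
  using (_↭_; ↭-refl; ↭-sym; ↭-prep; ↭-swap; ↭⇒↭ₛ; module PermutationReasoning)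
open import Data.List.Relation.Binary.Permutation.Propositional.Properties
  using (All-resp-↭; ↭-reverse; ++⁺ʳ) renaming (shift to ↭-shift)
import Data.List.Relation.Binary.Permutation.Setoid.Properties as PermutationSetoid
open import Data.Nat using (ℕ; zero; suc; pred; _+_; _*_; _≤_; _<_; _≥_; _<ᵇ_; _!)
open import Data.Nat.Properties
  using (_≟_; _≤?_; <⇒<ᵇ; <ᵇ⇒<; ≤⇒≯; ≰⇒>; n<1+n; n≤1+n; m<n⇒m<1+n; <-irrefl; <⇒≢; *-comm)
open import Data.Product using (_×_; _,_; proj₁; proj₂; map₁; map₂)
open import Function using (_∘_)
open import Relation.Binary.Definitions using (DecidableEquality)
open import Relation.Binary.PropositionalEquality
  using (_≡_; _≢_; refl; sym; trans; cong; cong₂; subst; setoid; module ≡-Reasoning)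
open import Relation.Nullary using (yes; no; ¬?; contradiction)

Letter : Set
Letter = ℕ × Decoration

values : PegPerm → List ℕ
values = map proj₁

Unbulleted : PegPerm → Set
Unbulleted = All ((_≢ bullet) ∘ proj₂)

record WellFormed (n : ℕ) (w : PegPerm) : Set where
  field
    length≡    : length w ≡ n
    unbulleted : Unbulleted w
    distinct   : Unique (values w)
open WellFormed

Unique-resp-↭ : ∀ {a} {A : Set a} {xs ys : List A} → xs ↭ ys → Unique xs → Unique ys
Unique-resp-↭ p = PermutationSetoid.Unique-resp-↭ (setoid _) (↭⇒↭ₛ p)

length-cartesianProduct : ∀ {a b} {A : Set a} {B : Set b} (xs : List A) (ys : List B) →
                          length (cartesianProduct xs ys) ≡ length xs * length ys
length-cartesianProduct []       ys = refl
length-cartesianProduct (x ∷ xs) ys =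
  trans (length-++ (map (x ,_) ys)) (cong₂ _+_ (length-map (x ,_) ys) (length-cartesianProduct xs ys))

deduplicate-unique : ∀ {a} {A : Set a} (_≟_ : DecidableEquality A) {xs : List A} →
                     Unique xs → deduplicate _≟_ xs ≡ xs
deduplicate-unique _≟_ {[]}     []           = refl
deduplicate-unique _≟_ {x ∷ xs} (x∉xs ∷ xs!)
  rewrite deduplicate-unique _≟_ xs! = cong (x ∷_) (filter-all (¬? ∘ (x ≟_)) x∉xs)

<ᵇ-true : ∀ {m n} → m < n → (m <ᵇ n) ≡ true
<ᵇ-true {m} {n} m<n with m <ᵇ n | <⇒<ᵇ m<n
... | true | _ = refl

<ᵇ-false : ∀ {m n} → n ≤ m → (m <ᵇ n) ≡ false
<ᵇ-false {m} {n} n≤m with m <ᵇ n | <ᵇ⇒< m n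
... | false | _   = refl
... | true  | m<n = contradiction (m<n _) (≤⇒≯ n≤m)

shift : ℕ → ℕ → ℕ
shift v x = if v <ᵇ x then suc x else x

shift-≤ : ∀ {v x} → x ≤ v → shift v x ≡ x
shift-≤ x≤v rewrite <ᵇ-false x≤v = refl

shift-> : ∀ {v x} → v < x → shift v x ≡ suc x
shift-> v<x rewrite <ᵇ-true v<x = refl

unshift : ℕ → ℕ → ℕ
unshift v y = if v <ᵇ y then pred y else y

unshift-shift : ∀ v x → unshift v (shift v x) ≡ x
unshift-shift v x with x ≤? v
... | yes x≤v rewrite shift-≤ x≤v | <ᵇ-false x≤v = refl
... | no  x≰v rewrite shift-> (≰⇒> x≰v) | <ᵇ-true (m<n⇒m<1+n (≰⇒> x≰v)) = refl

shift-injective : ∀ v {x y} → shift v x ≡ shift v y → x ≡ y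
shift-injective v {x} {y} eq = begin
  x                      ≡⟨ sym (unshift-shift v x) ⟩
  unshift v (shift v x)  ≡⟨ cong (unshift v) eq ⟩
  unshift v (shift v y)  ≡⟨ unshift-shift v y ⟩
  y                      ∎
  where open ≡-Reasoning

suc≢shift : ∀ v x → suc v ≢ shift v x
suc≢shift v x with x ≤? v
... | yes x≤v rewrite shift-≤ x≤v      = λ { refl → ≤⇒≯ x≤v (n<1+n v) }
... | no  x≰v rewrite shift-> (≰⇒> x≰v) = λ { refl → <-irrefl refl (≰⇒> x≰v) }

≢shift : ∀ {v x} → v ≢ x → v ≢ shift v x
≢shift {v} {x} v≢x with x ≤? v
... | yes x≤v rewrite shift-≤ x≤v      = v≢x
... | no  x≰v rewrite shift-> (≰⇒> x≰v) = λ { refl → ≤⇒≯ (n≤1+n x) (≰⇒> x≰v) }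

Unique-insert-suc : ∀ {v xs} → Unique (v ∷ xs) → Unique (v ∷ suc v ∷ map (shift v) xs)
Unique-insert-suc {v} {xs} (v∉xs ∷ xs!) =
  (<⇒≢ (n<1+n v) ∷ All.map⁺ (All.map ≢shift v∉xs))
  ∷ All.map⁺ (All.universal (suc≢shift v) xs)
  ∷ Unique.map⁺ (shift-injective v) xs!

unbump : ℕ → PegPerm → PegPerm
unbump v = map (map₁ (unshift v))

unbump-bump : ∀ v w → unbump v (bump v w) ≡ w
unbump-bump v []            = refl
unbump-bump v ((x , e) ∷ w) = cong₂ _∷_ (cong (_, e) (unshift-shift v x)) (unbump-bump v w)

values-bump : ∀ v w → values (bump v w) ≡ map (shift v) (values w)
values-bump v []            = refl
values-bump v ((x , e) ∷ w) = cong (shift v x ∷_) (values-bump v w)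

length-bump : ∀ v w → length (bump v w) ≡ length w
length-bump v = length-map _

bump-unbulleted : ∀ {v w} → Unbulleted w → Unbulleted (bump v w)
bump-unbulleted = All.map⁺

flipD-involutive : ∀ d → flipD (flipD d) ≡ d
flipD-involutive plus   = refl
flipD-involutive minus  = refl
flipD-involutive bullet = refl

flipD-unbulleted : ∀ {d} → d ≢ bullet → flipD d ≢ bullet
flipD-unbulleted {plus}   _  ()
flipD-unbulleted {minus}  _  ()
flipD-unbulleted {bullet} d≢• = contradiction refl d≢•

flipLetter : Letter → Letter
flipLetter = map₂ flipD

revFlip-involutive : ∀ w → revFlip (revFlip w) ≡ w
revFlip-involutive w = begin
  reverse (map flipLetter (reverse (map flipLetter w)))
    ≡⟨ cong reverse (reverse-map flipLetter (map flipLetter w)) ⟩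
  reverse (reverse (map flipLetter (map flipLetter w)))  ≡⟨ reverse-involutive _ ⟩
  map flipLetter (map flipLetter w)                      ≡⟨ map-∘ w ⟨
  map (flipLetter ∘ flipLetter) w                        ≡⟨ map-cong flipLetter-involutive w ⟩
  map (λ l → l) w                                        ≡⟨ map-id w ⟩
  w                                                      ∎
  where
  open ≡-Reasoning
  flipLetter-involutive : ∀ l → flipLetter (flipLetter l) ≡ l
  flipLetter-involutive (x , e) = cong (x ,_) (flipD-involutive e)

length-revFlip : ∀ w → length (revFlip w) ≡ length w
length-revFlip w = trans (length-reverse (map flipLetter w)) (length-map flipLetter w)

values-revFlip : ∀ w → values (revFlip w) ≡ reverse (values w)
values-revFlip w = begin
  map proj₁ (reverse (map flipLetter w))  ≡⟨ reverse-map proj₁ (map flipLetter w) ⟩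
  reverse (map proj₁ (map flipLetter w))  ≡⟨ cong reverse (map-∘ w) ⟨
  reverse (map proj₁ w)                   ∎
  where open ≡-Reasoning

revFlip-unbulleted : ∀ {w} → Unbulleted w → Unbulleted (revFlip w)
revFlip-unbulleted {w} nb =
  All-resp-↭ (↭-sym (↭-reverse (map flipLetter w))) (All.map⁺ (All.map flipD-unbulleted nb))

values-revFlip-bump : ∀ v α → values (revFlip (bump v α)) ↭ map (shift v) (values α)
values-revFlip-bump v α = begin
  values (revFlip (bump v α))        ≡⟨ values-revFlip (bump v α) ⟩
  reverse (values (bump v α))        ≡⟨ cong reverse (values-bump v α) ⟩
  reverse (map (shift v) (values α)) ↭⟨ ↭-reverse _ ⟩
  map (shift v) (values α)           ∎
  where open PermutationReasoning

-- expandAt α v e β is [ graft x y v α β ], where x , y is (v , minus) , (suc v , plus) for e = plus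
-- and the swapped pair for e = minus.
graft : Letter → Letter → ℕ → PegPerm → PegPerm → PegPerm
graft x y v α β = x ∷ revFlip (bump v α) ++ y ∷ bump v β

length-graft : ∀ x y v α z β → length (graft x y v α β) ≡ suc (length (α ++ z ∷ β))
length-graft x y v α z β = cong suc (begin
  length (revFlip (bump v α) ++ y ∷ bump v β)            ≡⟨ length-++ (revFlip (bump v α)) ⟩
  length (revFlip (bump v α)) + suc (length (bump v β))
    ≡⟨ cong₂ (λ a b → a + suc b) length-α (length-bump v β) ⟩
  length α + suc (length β)                              ≡⟨ length-++ α ⟨
  length (α ++ z ∷ β)                                    ∎)
  where
  open ≡-Reasoning
  length-α : length (revFlip (bump v α)) ≡ length α
  length-α = trans (length-revFlip (bump v α)) (length-bump v α)

graft-unbulleted : ∀ {x y v α z β} → proj₂ x ≢ bullet → proj₂ y ≢ bullet →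
                   Unbulleted (α ++ z ∷ β) → Unbulleted (graft x y v α β)
graft-unbulleted {α = α} x≢• y≢• nb with All.++⁻ α nb
... | nbα , _ ∷ nbβ =
  x≢• ∷ All.++⁺ (revFlip-unbulleted (bump-unbulleted nbα)) (y≢• ∷ bump-unbulleted nbβ)

values-graft : ∀ x y v α β →
               values (graft x y v α β) ↭ proj₁ x ∷ proj₁ y ∷ map (shift v) (values α ++ values β)
values-graft (a , _) (b , d) v α β = begin
  a ∷ values (revFlip (bump v α) ++ (b , d) ∷ bump v β)  ≡⟨ cong (a ∷_) (map-++ proj₁ (revFlip (bump v α)) _) ⟩
  a ∷ values (revFlip (bump v α)) ++ b ∷ values (bump v β)
    ↭⟨ ↭-prep a (++⁺ʳ _ (values-revFlip-bump v α)) ⟩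
  a ∷ sα ++ b ∷ values (bump v β)  ≡⟨ cong (λ bs → a ∷ sα ++ b ∷ bs) (values-bump v β) ⟩
  a ∷ sα ++ b ∷ sβ                 ↭⟨ ↭-prep a (↭-shift b sα sβ) ⟩
  a ∷ b ∷ sα ++ sβ                 ≡⟨ cong (λ cs → a ∷ b ∷ cs) (map-++ (shift v) (values α) (values β)) ⟨
  a ∷ b ∷ map (shift v) (values α ++ values β)  ∎
  where
  open PermutationReasoning
  sα sβ : List ℕ
  sα = map (shift v) (values α)
  sβ = map (shift v) (values β)

Unique-remove : ∀ α z β → Unique (values (α ++ z ∷ β)) → Unique (proj₁ z ∷ values α ++ values β)
Unique-remove α z β u =
  Unique-resp-↭ (↭-shift (proj₁ z) (values α) (values β)) (subst Unique (map-++ proj₁ α (z ∷ β)) u)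

wellFormed-graft : ∀ {n x y v α z β} → proj₂ x ≢ bullet → proj₂ y ≢ bullet →
                   Unique (proj₁ x ∷ proj₁ y ∷ map (shift v) (values α ++ values β)) →
                   WellFormed n (α ++ z ∷ β) → WellFormed (suc n) (graft x y v α β)
wellFormed-graft {x = x} {y} {v} {α} {z} {β} x≢• y≢• xy! wf = record
  { length≡    = trans (length-graft x y v α z β) (cong suc (length≡ wf))
  ; unbulleted = graft-unbulleted x≢• y≢• (unbulleted wf)
  ; distinct   = Unique-resp-↭ (↭-sym (values-graft x y v α β)) xy!
  }

Unique-expansion : ∀ {n} α v e β → WellFormed n (α ++ (v , e) ∷ β) →
                   Unique (v ∷ suc v ∷ map (shift v) (values α ++ values β))
Unique-expansion α v e β wf = Unique-insert-suc (Unique-remove α (v , e) β (distinct wf))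

wellFormed-expandAt : ∀ {n} α v e β → WellFormed n (α ++ (v , e) ∷ β) →
                      All (WellFormed (suc n)) (expandAt α v e β)
wellFormed-expandAt α v plus β wf =
  wellFormed-graft (λ ()) (λ ()) (Unique-expansion α v plus β wf) wf ∷ []
wellFormed-expandAt α v minus β wf =
  wellFormed-graft (λ ()) (λ ()) (Unique-resp-↭ (↭-swap v (suc v) ↭-refl) (Unique-expansion α v minus β wf)) wf ∷ []
wellFormed-expandAt α v bullet β wf = []

wellFormed-childrenAux : ∀ {n} α β → WellFormed n (α ++ β) → All (WellFormed (suc n)) (childrenAux α β)
wellFormed-childrenAux α []            wf = []
wellFormed-childrenAux α ((v , e) ∷ β) wf =
  All.++⁺ (wellFormed-expandAt α v e β wf)
          (wellFormed-childrenAux (α ++ [ (v , e) ]) β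
                                  (subst (WellFormed _) (sym (++-assoc α [ (v , e) ] β)) wf))

wellFormed-children : ∀ {n Ls} → All (WellFormed n) Ls → All (WellFormed (suc n)) (concatMap children Ls)
wellFormed-children = All.concat⁺ ∘ All.map⁺ ∘ All.map (wellFormed-childrenAux [] _)

breakAt : ℕ → PegPerm → PegPerm × PegPerm
breakAt v []            = [] , []
breakAt v ((x , e) ∷ w) with v ≟ x
... | yes _ = [] , w
... | no  _ = map₁ ((x , e) ∷_) (breakAt v w)

breakAt-++ : ∀ {v} γ e δ → All (v ≢_) (values γ) → breakAt v (γ ++ (v , e) ∷ δ) ≡ (γ , δ)
breakAt-++ {v} [] e δ [] with v ≟ v
... | yes _   = refl
... | no  v≢v = contradiction refl v≢v
breakAt-++ {v} ((x , d) ∷ γ) e δ (v≢x ∷ v∉γ) with v ≟ x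
... | yes v≡x = contradiction v≡x v≢x
... | no  _   = cong (map₁ ((x , d) ∷_)) (breakAt-++ γ e δ v∉γ)

restore : ℕ → Decoration → PegPerm × PegPerm → PegPerm × ℕ
restore v e (γ , δ) = unbump v (revFlip γ) ++ (v , e) ∷ unbump v δ , length δ

-- The first letter of a child fixes v and the partner letter to break at; undoing the reversal and
-- the bump on the two halves recovers the parent, and the length of β records the position.
decode : PegPerm → PegPerm × ℕ
decode ((v , minus) ∷ w)    = restore v plus (breakAt (suc v) w)
decode ((suc v , plus) ∷ w) = restore v minus (breakAt v w)
decode _                    = [] , 0

restore-graft : ∀ v e α β → restore v e (revFlip (bump v α) , bump v β) ≡ (α ++ (v , e) ∷ β , length β)
restore-graft v e α β = cong₂ _,_
  (cong₂ (λ γ δ → γ ++ (v , e) ∷ δ)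
         (trans (cong (unbump v) (revFlip-involutive (bump v α))) (unbump-bump v α))
         (unbump-bump v β))
  (length-bump v β)

decode-expandAt : ∀ α v e β → e ≢ bullet → All (v ≢_) (values α) →
                  map decode (expandAt α v e β) ≡ [ (α ++ (v , e) ∷ β , length β) ]
decode-expandAt α v plus β _ _ = cong [_] (trans
  (cong (restore v plus) (breakAt-++ _ plus (bump v β) avoids))
  (restore-graft v plus α β))
  where
  avoids : All (suc v ≢_) (values (revFlip (bump v α)))
  avoids = All-resp-↭ (↭-sym (values-revFlip-bump v α)) (All.map⁺ (All.universal (suc≢shift v) (values α)))
decode-expandAt α v minus β _ v∉α = cong [_] (trans
  (cong (restore v minus) (breakAt-++ _ minus (bump v β) avoids))
  (restore-graft v minus α β))
  where
  avoids : All (v ≢_) (values (revFlip (bump v α)))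
  avoids = All-resp-↭ (↭-sym (values-revFlip-bump v α)) (All.map⁺ (All.map ≢shift v∉α))
decode-expandAt α v bullet β •≢• _ = contradiction refl •≢•

decode-childrenAux : ∀ α β → Unbulleted β → Unique (values (α ++ β)) →
                     map decode (childrenAux α β) ≡ map (α ++ β ,_) (downFrom (length β))
decode-childrenAux α []            _           _ = refl
decode-childrenAux α ((v , e) ∷ β) (e≢• ∷ nbβ) u = begin
  map decode (expandAt α v e β ++ childrenAux (α ++ [ (v , e) ]) β)
    ≡⟨ map-++ decode (expandAt α v e β) _ ⟩
  map decode (expandAt α v e β) ++ map decode (childrenAux (α ++ [ (v , e) ]) β)
    ≡⟨ cong₂ _++_ (decode-expandAt α v e β e≢• v∉α) rest ⟩
  map (α ++ (v , e) ∷ β ,_) (downFrom (suc (length β)))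
    ∎
  where
  open ≡-Reasoning
  assoc : (α ++ [ (v , e) ]) ++ β ≡ α ++ (v , e) ∷ β
  assoc = ++-assoc α [ (v , e) ] β
  v∉α : All (v ≢_) (values α)
  v∉α = All.++⁻ˡ (values α) (AllPairs.head (Unique-remove α (v , e) β u))
  rest : map decode (childrenAux (α ++ [ (v , e) ]) β) ≡ map (α ++ (v , e) ∷ β ,_) (downFrom (length β))
  rest = trans (decode-childrenAux (α ++ [ (v , e) ]) β nbβ (subst (Unique ∘ values) (sym assoc) u))
               (cong (λ p → map (p ,_) (downFrom (length β))) assoc)

decode-children : ∀ {n Ls} → All (WellFormed n) Ls →
                  map decode (concatMap children Ls) ≡ cartesianProduct Ls (downFrom n)
decode-children {Ls = []}     []         = refl
decode-children {Ls = p ∷ Ls} (wf ∷ wfs) = trans (map-++ decode (children p) _) (cong₂ _++_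
  (trans (decode-childrenAux [] p (unbulleted wf) (distinct wf))
         (cong (λ m → map (p ,_) (downFrom m)) (length≡ wf)))
  (decode-children wfs))

children-unique : ∀ {n Ls} → All (WellFormed n) Ls → Unique Ls → Unique (concatMap children Ls)
children-unique {n} wfs Ls! =
  Unique.map⁻ (subst Unique (sym (decode-children wfs)) (Unique.cartesianProduct⁺ Ls! (Unique.downFrom⁺ n)))

length-children : ∀ {n Ls} → All (WellFormed n) Ls → length (concatMap children Ls) ≡ length Ls * n
length-children {n} {Ls} wfs = begin
  length (concatMap children Ls)               ≡⟨ length-map decode (concatMap children Ls) ⟨
  length (map decode (concatMap children Ls))  ≡⟨ cong length (decode-children wfs) ⟩
  length (cartesianProduct Ls (downFrom n))    ≡⟨ length-cartesianProduct Ls _ ⟩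
  length Ls * length (downFrom n)              ≡⟨ cong (length Ls *_) (length-downFrom n) ⟩
  length Ls * n                                ∎
  where open ≡-Reasoning

mutual
  G-wellFormed-unique : ∀ k → All (WellFormed (suc (suc k))) (G (suc k)) × Unique (G (suc k))
  G-wellFormed-unique zero = wf ∷ [] , [] ∷ []
    where
    wf : WellFormed 2 ((1 , minus) ∷ (2 , plus) ∷ [])
    wf = record { length≡ = refl ; unbulleted = (λ ()) ∷ (λ ()) ∷ [] ; distinct = ((λ ()) ∷ []) ∷ [] ∷ [] }
  G-wellFormed-unique (suc k) =
    let wfs , G! = G-wellFormed-unique k
    in subst (λ Ls → All (WellFormed (suc (suc (suc k)))) Ls × Unique Ls) (sym (G-step k))
             (wellFormed-children wfs , children-unique wfs G!)

  G-step : ∀ k → G (suc (suc k)) ≡ concatMap children (G (suc k))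
  G-step k = let wfs , G! = G-wellFormed-unique k in deduplicate-unique _≟P_ (children-unique wfs G!)

length-G : ∀ k → length (G (suc k)) ≡ suc k !
length-G zero    = refl
length-G (suc k) = begin
  length (G (suc (suc k)))                 ≡⟨ cong length (G-step k) ⟩
  length (concatMap children (G (suc k)))  ≡⟨ length-children (proj₁ (G-wellFormed-unique k)) ⟩
  length (G (suc k)) * suc (suc k)         ≡⟨ cong (_* suc (suc k)) (length-G k) ⟩
  suc k ! * suc (suc k)                    ≡⟨ *-comm (suc k !) (suc (suc k)) ⟩
  suc (suc k) !                            ∎
  where open ≡-Reasoning

mainTheorem5 : (k : ℕ) → k ≥ 1 → length (G k) ≡ k !
mainTheorem5 zero    ()
mainTheorem5 (suc k) _ = length-G k
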